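{- For all non-negative integers $m$ and $n$: (a) $T_{m+n}=T_{m}T_{n+1}+T_{n}\left(T_{m-1}+T_{m-2}\right)+T_{m-1}T_{n-1}$; (b) $K_{m+n}=T_{m}K_{n+1}+K_{n}\left(T_{m-1}+T_{m-2}\right)+K_{n-1}T_{m-1}$; (c) $K_{m}K_{n+1}+K_{n}\left(K_{m-1}+K_{m-2}\right)+K_{m-1}K_{n-1}=9T_{m+n+2}-12T_{m+n+1}-2T_{m+n}+4T_{m+n-1}+T_{m+n-2}$; (d) $K_{m}K_{n+1}+K_{n}\left(K_{m-1}+K_{m-2}\right)+K_{m-1}K_{n-1}=T_{m+n}+4T_{m+n-1}+10T_{m+n-2}+12T_{m+n-3}+9T_{m+n-4}$; (e) $K_{m}K_{n+1}+K_{n}\left(K_{m-1}+K_{m-2}\right)+K_{m-1}K_{n-1}=T_{m+n}-8T_{m+n+1}+18T_{m+n+2}-8T_{m+n+3}+T_{m+n+4}$.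
   Context: The Tribonacci numbers $T_n$ and Tribonacci–Lucas numbers $K_n$ are defined for all integers $n$ by $T_n=T_{n-1}+T_{n-2}+T_{n-3}$ with $T_0=0,T_1=1,T_2=1$, and $K_n=K_{n-1}+K_{n-2}+K_{n-3}$ with $K_0=3,K_1=1,K_2=3$; negative indices are defined by running the recurrences backwards, i.e. $T_{ -n}=-T_{ -(n-1)}-T_{ -(n-2)}+T_{ -(n-3)}$ and $K_{ -n}=-K_{ -(n-1)}-K_{ -(n-2)}+K_{ -(n-3)}$ for $n\geq1$. -}

module Defs where

open import Data.Nat using (ℕ; zero; suc)
open import Data.Integer using (ℤ; +_; -[1+_]; _+_; _-_; -_)

fwd : ℤ → ℤ → ℤ → ℕ → ℤ
fwd a0 a1 a2 zero = a0
fwd a0 a1 a2 (suc n) = fwd a1 a2 (a2 + a1 + a0) n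

-- Backward values b_n = a_{-n} (n ≥ 0), given a_0, a_{-1}, a_{-2},
-- via a_{-(n+3)} = a_{-n} - a_{-(n+1)} - a_{-(n+2)}.
bwd : ℤ → ℤ → ℤ → ℕ → ℤ
bwd b0 b1 b2 zero = b0
bwd b0 b1 b2 (suc n) = bwd b1 b2 (b0 - b1 - b2) n

-- Tribonacci numbers T_n for all integers n: T_0 = 0, T_1 = 1, T_2 = 1.
-- Backward: T_{-1} = T_2 - T_1 - T_0 = 0, T_{-2} = T_1 - T_0 - T_{-1} = 1.
T : ℤ → ℤ
T (+ n) = fwd (+ 0) (+ 1) (+ 1) n
T -[1+ n ] = bwd (+ 0) (+ 0) (+ 1) (suc n)

-- Tribonacci–Lucas numbers K_n: K_0 = 3, K_1 = 1, K_2 = 3.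
-- Backward: K_{-1} = K_2 - K_1 - K_0 = -1, K_{-2} = K_1 - K_0 - K_{-1} = -1.
K : ℤ → ℤ
K (+ n) = fwd (+ 3) (+ 1) (+ 3) n
K -[1+ n ] = bwd (+ 3) (- (+ 1)) (- (+ 1)) (suc n)

{-# OPTIONS --safe #-}
-- Write B f g m n = f m g(n+1) + g n (f(m-1) + f(m-2)) + f(m-1) g(n-1) (additionForm);
-- the right-hand sides of (a) and (b) are B T T m n and B T K m n, and the left-hand side
-- of (c)-(e) is B K K m n. For f and g satisfying the tribonacci recurrence on all of ℤ,
-- the recurrence for f and for g gives B f g (m+1) n = B f g m (n+1), so B f g m n depends
-- only on m + n. As T 0 = T (-1) = 0 and T (-2) = T 1 = 1, moving the whole sum onto the
-- T-argument yields B T g m n = g (m + n), which is (a) and (b), and B f T c s = f (s + c),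
-- which writes every shifted T or K in the basis T (s+1), T s, T (s-1). In that basis
-- B K K m n = -2 T(s+1) + 6 T s + 12 T(s-1) with s = m + n, and (c)-(e) become integer
-- linear identities.
module Submission where

open import Defs
open import Data.Nat as ℕ using (ℕ; zero; suc)
open import Data.Integer using (ℤ; +_; -[1+_]; 0ℤ; _+_; _-_; _*_; -_)
open import Data.Integer.Properties using (+-assoc; +-comm; +-identityˡ; +-identityʳ; *-comm)
open import Data.Integer.Tactic.RingSolver using (solve-∀)
open import Data.Product using (_×_; _,_)
open import Relation.Binary.PropositionalEquality
  using (_≡_; refl; sym; trans; cong; cong₂; module ≡-Reasoning)

record Rec (f : ℤ → ℤ) : Set where
  field
    recurrence : ∀ k → f (k + + 3) ≡ f (k + + 2) + f (k + + 1) + f k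

open Rec

fwd-rec : ∀ a b c n → fwd a b c (n ℕ.+ 3) ≡ fwd a b c (n ℕ.+ 2) + fwd a b c (n ℕ.+ 1) + fwd a b c n
fwd-rec a b c zero    = refl
fwd-rec a b c (suc n) = fwd-rec b c (c + b + a) n

bwd-rec : ∀ a b c n → bwd a b c (3 ℕ.+ n) ≡ bwd a b c n - bwd a b c (1 ℕ.+ n) - bwd a b c (2 ℕ.+ n)
bwd-rec a b c zero    = refl
bwd-rec a b c (suc n) = bwd-rec b c (a - b - c) n

w≡x-y-z⇒x≡y+z+w : ∀ {x y z w} → w ≡ x - y - z → x ≡ y + z + w
w≡x-y-z⇒x≡y+z+w {x} {y} {z} refl = lemma x y z
  where
  lemma : ∀ x y z → x ≡ y + z + (x - y - z)
  lemma = solve-∀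

T-rec : Rec T
T-rec .recurrence (+ n)                    = fwd-rec _ _ _ n
T-rec .recurrence -[1+ 0 ]                 = refl
T-rec .recurrence -[1+ 1 ]                 = refl
T-rec .recurrence -[1+ 2 ]                 = refl
T-rec .recurrence -[1+ suc (suc (suc j)) ] = w≡x-y-z⇒x≡y+z+w (bwd-rec (+ 0) (+ 0) (+ 1) (suc j))

K-rec : Rec K
K-rec .recurrence (+ n)                    = fwd-rec _ _ _ n
K-rec .recurrence -[1+ 0 ]                 = refl
K-rec .recurrence -[1+ 1 ]                 = refl
K-rec .recurrence -[1+ 2 ]                 = refl
K-rec .recurrence -[1+ suc (suc (suc j)) ] = w≡x-y-z⇒x≡y+z+w (bwd-rec (+ 3) (- + 1) (- + 1) (suc j))

rec-centred : ∀ {f} → Rec f → ∀ k → f (k + + 1) ≡ f k + f (k - + 1) + f (k - + 2)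
rec-centred {f} rf k = begin
  f (k + + 1)                                            ≡⟨ cong f (k+1≡[k-2]+3 k) ⟩
  f (k - + 2 + + 3)                                      ≡⟨ recurrence rf (k - + 2) ⟩
  f (k - + 2 + + 2) + f (k - + 2 + + 1) + f (k - + 2)    ≡⟨ cong₂ (λ a b → f a + f b + f (k - + 2)) ([k-2]+2≡k k) ([k-2]+1≡k-1 k) ⟩
  f k + f (k - + 1) + f (k - + 2)                        ∎
  where
  open ≡-Reasoning
  k+1≡[k-2]+3 : ∀ k → k + + 1 ≡ k - + 2 + + 3
  k+1≡[k-2]+3 = solve-∀
  [k-2]+2≡k : ∀ k → k - + 2 + + 2 ≡ k
  [k-2]+2≡k = solve-∀
  [k-2]+1≡k-1 : ∀ k → k - + 2 + + 1 ≡ k - + 1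
  [k-2]+1≡k-1 = solve-∀

[k+1]-1≡k : ∀ k → k + + 1 - + 1 ≡ k
[k+1]-1≡k = solve-∀

[k+1]-2≡k-1 : ∀ k → k + + 1 - + 2 ≡ k - + 1
[k+1]-2≡k-1 = solve-∀

cong₃ : ∀ {A B C D : Set} (h : A → B → C → D) {a a′ b b′ c c′} →
        a ≡ a′ → b ≡ b′ → c ≡ c′ → h a b c ≡ h a′ b′ c′
cong₃ h refl refl refl = refl

additionForm : (ℤ → ℤ) → (ℤ → ℤ) → ℤ → ℤ → ℤ
additionForm f g m n = f m * g (n + + 1) + g n * (f (m - + 1) + f (m - + 2)) + f (m - + 1) * g (n - + 1)

module _ {f g : ℤ → ℤ} (rf : Rec f) (rg : Rec g) where

  additionForm-step : ∀ m n → additionForm f g (m + + 1) n ≡ additionForm f g m (n + + 1)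
  additionForm-step m n = begin
    additionForm f g (m + + 1) n
      ≡⟨ cong₂ (λ a b → a * g (n + + 1) + g n * (b + f (m + + 1 - + 2)) + b * g (n - + 1))
               (rec-centred rf m) (cong f ([k+1]-1≡k m)) ⟩
    (f m + f (m - + 1) + f (m - + 2)) * g (n + + 1) + g n * (f m + f (m + + 1 - + 2)) + f m * g (n - + 1)
      ≡⟨ cong (λ c → (f m + f (m - + 1) + f (m - + 2)) * g (n + + 1) + g n * (f m + c) + f m * g (n - + 1))
              (cong f ([k+1]-2≡k-1 m)) ⟩
    (f m + f (m - + 1) + f (m - + 2)) * g (n + + 1) + g n * (f m + f (m - + 1)) + f m * g (n - + 1)
      ≡⟨ identity (f m) (f (m - + 1)) (f (m - + 2)) (g (n + + 1)) (g n) (g (n - + 1)) ⟩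
    f m * (g (n + + 1) + g n + g (n - + 1)) + g (n + + 1) * (f (m - + 1) + f (m - + 2)) + f (m - + 1) * g n
      ≡⟨ sym (cong₂ (λ a b → f m * a + g (n + + 1) * (f (m - + 1) + f (m - + 2)) + f (m - + 1) * b)
                    g-up (cong g ([k+1]-1≡k n))) ⟩
    additionForm f g m (n + + 1) ∎
    where
    open ≡-Reasoning
    g-up : g (n + + 1 + + 1) ≡ g (n + + 1) + g n + g (n - + 1)
    g-up = trans (rec-centred rg (n + + 1))
                 (cong₂ (λ a b → g (n + + 1) + g a + g b) ([k+1]-1≡k n) ([k+1]-2≡k-1 n))
    identity : ∀ a b c x y z →
      (a + b + c) * x + y * (a + b) + a * z ≡ a * (x + y + z) + x * (b + c) + b * y
    identity = solve-∀

  additionForm-slide : ∀ m n → additionForm f g m n ≡ additionForm f g (m + n) 0ℤ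
  additionForm-slide m (+ j)    = slide-up j m
    where
    open ≡-Reasoning
    slide-up : ∀ j m → additionForm f g m (+ j) ≡ additionForm f g (m + + j) 0ℤ
    slide-up zero    m = cong (λ x → additionForm f g x 0ℤ) (sym (+-identityʳ m))
    slide-up (suc j) m = begin
      additionForm f g m (+ suc j)          ≡⟨ cong (additionForm f g m) (+-comm (+ 1) (+ j)) ⟩
      additionForm f g m (+ j + + 1)        ≡⟨ sym (additionForm-step m (+ j)) ⟩
      additionForm f g (m + + 1) (+ j)      ≡⟨ slide-up j (m + + 1) ⟩
      additionForm f g (m + + 1 + + j) 0ℤ   ≡⟨ cong (λ x → additionForm f g x 0ℤ) (+-assoc m (+ 1) (+ j)) ⟩
      additionForm f g (m + + suc j) 0ℤ     ∎
  additionForm-slide m -[1+ j ] = slide-down (suc j) m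
    where
    open ≡-Reasoning
    [k-1]+1≡k : ∀ k → k - + 1 + + 1 ≡ k
    [k-1]+1≡k = solve-∀
    -[1+x]+1≡-x : ∀ x → - (+ 1 + x) + + 1 ≡ - x
    -[1+x]+1≡-x = solve-∀
    k-1-x≡k-[1+x] : ∀ k x → k - + 1 - x ≡ k - (+ 1 + x)
    k-1-x≡k-[1+x] = solve-∀
    slide-down : ∀ j m → additionForm f g m (- + j) ≡ additionForm f g (m - + j) 0ℤ
    slide-down zero    m = cong (λ x → additionForm f g x 0ℤ) (sym (+-identityʳ m))
    slide-down (suc j) m = begin
      additionForm f g m (- + suc j)                ≡⟨ cong (λ x → additionForm f g x (- + suc j)) (sym ([k-1]+1≡k m)) ⟩
      additionForm f g (m - + 1 + + 1) (- + suc j)  ≡⟨ additionForm-step (m - + 1) (- + suc j) ⟩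
      additionForm f g (m - + 1) (- + suc j + + 1)  ≡⟨ cong (additionForm f g (m - + 1)) (-[1+x]+1≡-x (+ j)) ⟩
      additionForm f g (m - + 1) (- + j)            ≡⟨ slide-down j (m - + 1) ⟩
      additionForm f g (m - + 1 - + j) 0ℤ           ≡⟨ cong (λ x → additionForm f g x 0ℤ) (k-1-x≡k-[1+x] m (+ j)) ⟩
      additionForm f g (m - + suc j) 0ℤ             ∎

  additionForm-sum : ∀ m n m′ n′ → m + n ≡ m′ + n′ → additionForm f g m n ≡ additionForm f g m′ n′
  additionForm-sum m n m′ n′ eq = begin
    additionForm f g m n            ≡⟨ additionForm-slide m n ⟩
    additionForm f g (m + n) 0ℤ     ≡⟨ cong (λ x → additionForm f g x 0ℤ) eq ⟩
    additionForm f g (m′ + n′) 0ℤ   ≡⟨ sym (additionForm-slide m′ n′) ⟩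
    additionForm f g m′ n′          ∎
    where open ≡-Reasoning

addition-formula : ∀ {g} → Rec g → ∀ m n → g (m + n) ≡ additionForm T g m n
addition-formula {g} rg m n = begin
  g (m + n)                        ≡⟨ sym (T-unit (g (m + n + + 1)) (g (m + n)) (g (m + n - + 1))) ⟩
  additionForm T g 0ℤ (m + n)      ≡⟨ additionForm-sum T-rec rg 0ℤ (m + n) m n (+-identityˡ (m + n)) ⟩
  additionForm T g m n             ∎
  where
  open ≡-Reasoning
  T-unit : ∀ x y z → + 0 * x + y * (+ 0 + + 1) + + 0 * z ≡ y
  T-unit = solve-∀

expansion : ∀ {f} → Rec f → ∀ k c → f (k + c) ≡ additionForm f T c k
expansion {f} rf k c = begin
  f (k + c)                        ≡⟨ sym (T-unit (f (k + c)) (f (k + c - + 1)) (f (k + c - + 2))) ⟩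
  additionForm f T (k + c) 0ℤ      ≡⟨ additionForm-sum rf T-rec (k + c) 0ℤ c k (trans (+-identityʳ (k + c)) (+-comm k c)) ⟩
  additionForm f T c k             ∎
  where
  open ≡-Reasoning
  T-unit : ∀ x y z → x * + 1 + + 0 * (y + z) + y * + 0 ≡ x
  T-unit = solve-∀

lucasProduct : ℤ → ℤ
lucasProduct s = - + 2 * T (s + + 1) + + 6 * T s + + 12 * T (s - + 1)

-- In the identities below the numerals are the values of T (resp. K) at c, c - 1, c - 2
-- to which additionForm T T c s (resp. additionForm K T c s) reduces.
additionForm-K-K : ∀ m n → additionForm K K m n ≡ lucasProduct (m + n)
additionForm-K-K m n = begin
  additionForm K K m n
    ≡⟨ additionForm-sum K-rec K-rec m n 0ℤ s (sym (+-identityˡ s)) ⟩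
  additionForm K K 0ℤ s
    ≡⟨ cong₃ (λ a b c → + 3 * a + b * (- + 1 + - + 1) + - + 1 * c)
             (expansion K-rec s (+ 1)) K-in-T (expansion K-rec s (- + 1)) ⟩
  + 3 * additionForm K T (+ 1) s + additionForm K T 0ℤ s * (- + 1 + - + 1) + - + 1 * additionForm K T (- + 1) s
    ≡⟨ identity (T (s + + 1)) (T s) (T (s - + 1)) ⟩
  lucasProduct s
    ∎
  where
  open ≡-Reasoning
  s = m + n
  K-in-T : K s ≡ additionForm K T 0ℤ s
  K-in-T = trans (cong K (sym (+-identityʳ s))) (expansion K-rec s 0ℤ)
  identity : ∀ x y z →
    + 3 * (+ 1 * x + y * (+ 3 + - + 1) + + 3 * z)
      + (+ 3 * x + y * (- + 1 + - + 1) + - + 1 * z) * (- + 1 + - + 1)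
      + - + 1 * (- + 1 * x + y * (- + 1 + + 5) + - + 1 * z)
    ≡ - + 2 * x + + 6 * y + + 12 * z
  identity = solve-∀

module _ (s : ℤ) where

  private
    x y z : ℤ
    x = T (s + + 1)
    y = T s
    z = T (s - + 1)

    T-expansion : ∀ c → T (s + c) ≡ additionForm T T c s
    T-expansion = expansion T-rec s

  lucasProduct-centred : lucasProduct s ≡ + 9 * T (s + + 2) - + 12 * x - + 2 * y + + 4 * z + T (s - + 2)
  lucasProduct-centred = sym (trans
    (cong₂ (λ a b → + 9 * a - + 12 * x - + 2 * y + + 4 * z + b) (T-expansion (+ 2)) (T-expansion (- + 2)))
    (identity x y z))
    where
    identity : ∀ x y z →
      + 9 * (+ 1 * x + y * (+ 1 + + 0) + + 1 * z) - + 12 * x - + 2 * y + + 4 * z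
        + (+ 1 * x + y * (- + 1 + + 0) + - + 1 * z)
      ≡ - + 2 * x + + 6 * y + + 12 * z
    identity = solve-∀

  lucasProduct-backward :
    lucasProduct s ≡ y + + 4 * z + + 10 * T (s - + 2) + + 12 * T (s - + 3) + + 9 * T (s - + 4)
  lucasProduct-backward = sym (trans
    (cong₃ (λ a b c → y + + 4 * z + + 10 * a + + 12 * b + + 9 * c)
           (T-expansion (- + 2)) (T-expansion (- + 3)) (T-expansion (- + 4)))
    (identity x y z))
    where
    identity : ∀ x y z →
      y + + 4 * z + + 10 * (+ 1 * x + y * (- + 1 + + 0) + - + 1 * z)
        + + 12 * (- + 1 * x + y * (+ 0 + + 2) + + 0 * z)
        + + 9 * (+ 0 * x + y * (+ 2 + - + 3) + + 2 * z)
      ≡ - + 2 * x + + 6 * y + + 12 * z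
    identity = solve-∀

  lucasProduct-forward :
    lucasProduct s ≡ y - + 8 * x + + 18 * T (s + + 2) - + 8 * T (s + + 3) + T (s + + 4)
  lucasProduct-forward = sym (trans
    (cong₃ (λ a b c → y - + 8 * x + + 18 * a - + 8 * b + c)
           (T-expansion (+ 2)) (T-expansion (+ 3)) (T-expansion (+ 4)))
    (identity x y z))
    where
    identity : ∀ x y z →
      y - + 8 * x + + 18 * (+ 1 * x + y * (+ 1 + + 0) + + 1 * z)
        - + 8 * (+ 2 * x + y * (+ 1 + + 1) + + 1 * z)
        + (+ 4 * x + y * (+ 2 + + 1) + + 2 * z)
      ≡ - + 2 * x + + 6 * y + + 12 * z
    identity = solve-∀

mainTheorem11 : (m n : ℕ) →
  let M = + m
      N = + n
      S = + m + + n
      KK = K M * K (N + + 1) + K N * (K (M - + 1) + K (M - + 2)) + K (M - + 1) * K (N - + 1)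
  in (T S ≡ T M * T (N + + 1) + T N * (T (M - + 1) + T (M - + 2)) + T (M - + 1) * T (N - + 1))
   × (K S ≡ T M * K (N + + 1) + K N * (T (M - + 1) + T (M - + 2)) + K (N - + 1) * T (M - + 1))
   × (KK ≡ + 9 * T (S + + 2) - + 12 * T (S + + 1) - + 2 * T S + + 4 * T (S - + 1) + T (S - + 2))
   × (KK ≡ T S + + 4 * T (S - + 1) + + 10 * T (S - + 2) + + 12 * T (S - + 3) + + 9 * T (S - + 4))
   × (KK ≡ T S - + 8 * T (S + + 1) + + 18 * T (S + + 2) - + 8 * T (S + + 3) + T (S + + 4))
mainTheorem11 m n =
    addition-formula T-rec M N
  , trans (addition-formula K-rec M N)
          (cong (_+_ (T M * K (N + + 1) + K N * (T (M - + 1) + T (M - + 2)))) (*-comm (T (M - + 1)) (K (N - + 1))))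
  , trans (additionForm-K-K M N) (lucasProduct-centred (M + N))
  , trans (additionForm-K-K M N) (lucasProduct-backward (M + N))
  , trans (additionForm-K-K M N) (lucasProduct-forward (M + N))
  where
  M N : ℤ
  M = + m
  N = + n
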